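{- Let $G$ be a simple graph and let $u$ be a simplicial vertex of $G$ with degree $k$. Then $$\tau(G,x)=x\,\tau'(G-u,x)+(x+k)\,\tau(G-u,x),$$ where $\tau'$ denotes the derivative with respect to $x$.
   Context: A vertex is simplicial if its neighbours are pairwise adjacent. For a simple graph $H$ of order $n$ with chromatic polynomial $\chi(H,x)$, the $c_i(H)$ are defined by $\chi(H,x)=\sum_{0\le i\le n}(-1)^{n-i}c_i(H)\langle x\rangle_i$, with $\langle x\rangle_i=x(x+1)\cdots(x+i-1)$, and $\tau(H,x)=\sum_{0\le i\le n}c_i(H)x^i$. -}

module Defs where

open import Data.Nat as ℕ using (ℕ; zero; suc; _≤ᵇ_)
open import Data.Integer as ℤ using (ℤ; +_; -1ℤ)
open import Data.Fin using (Fin; zero; suc; punchIn; _≟_)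
open import Relation.Nullary.Decidable using (T?)
open import Data.Bool using (T; Bool; true; false; not; _∧_; _∨_; if_then_else_)
open import Data.List using (List; []; _∷_; [_]; map; concatMap; filter; length; allFin; foldr)
open import Relation.Binary.PropositionalEquality using (_≡_; _≢_)
open import Relation.Nullary.Decidable using (⌊_⌋; does)

record Graph (n : ℕ) : Set where
  field
    adj    : Fin n → Fin n → Bool
    sym    : ∀ i j → adj i j ≡ adj j i
    irrefl : ∀ i → adj i i ≡ false
open Graph public

delete : ∀ {n} → Graph (suc n) → Fin (suc n) → Graph n
delete G u = record
  { adj    = λ i j → adj G (punchIn u i) (punchIn u j)
  ; sym    = λ i j → sym G (punchIn u i) (punchIn u j)
  ; irrefl = λ i → irrefl G (punchIn u i) }

degree : ∀ {n} → Graph n → Fin n → ℕ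
degree {n} G u = length (filter (λ v → T? (adj G u v)) (allFin n))

Simplicial : ∀ {n} → Graph n → Fin n → Set
Simplicial G u = ∀ v w → adj G u v ≡ true → adj G u w ≡ true → v ≢ w → adj G v w ≡ true

allMaps : (n x : ℕ) → List (Fin n → Fin x)
allMaps zero    x = [ (λ ()) ]
allMaps (suc n) x = concatMap (λ f → map (λ c → cons c f) (allFin x)) (allMaps n x)
  where
  cons : ∀ {x n} → Fin x → (Fin n → Fin x) → Fin (suc n) → Fin x
  cons c f zero    = c
  cons c f (suc i) = f i

andAll : List Bool → Bool
andAll = foldr _∧_ true

isProper : ∀ {n x} → Graph n → (Fin n → Fin x) → Bool
isProper {n} G f =
  andAll (concatMap (λ i → map (λ j → not (adj G i j) ∨ not (does (f i ≟ f j))) (allFin n)) (allFin n))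

-- chromatic polynomial evaluated at a natural number x: number of proper x-colourings
chrom : ∀ {n} → Graph n → ℕ → ℕ
chrom {n} G x = length (filter (λ f → T? (isProper G f)) (allMaps n x))

rising : ℕ → ℕ → ℕ
rising x zero    = 1
rising x (suc i) = rising x i ℕ.* (x ℕ.+ i)

sumTo : ℕ → (ℕ → ℤ) → ℤ
sumTo zero    f = f 0
sumTo (suc m) f = sumTo m f ℤ.+ f (suc m)

-- c is the coefficient sequence (c_0, ..., c_n) of H, i.e.
-- χ(H,x) = Σ_{0≤i≤n} (-1)^{n-i} c_i ⟨x⟩_i  (as polynomials; equivalently for all x ∈ ℕ)
IsCoeffs : ∀ {n} → Graph n → (ℕ → ℤ) → Set
IsCoeffs {n} H c = ∀ (x : ℕ) →
  + chrom H x ≡ sumTo n (λ i → (-1ℤ ℤ.^ (n ℕ.∸ i)) ℤ.* c i ℤ.* + rising x i)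

-- Polynomials over ℤ as coefficient sequences ℕ → ℤ (coefficient of x^i at i).
Poly : Set
Poly = ℕ → ℤ

-- τ(H,x) = Σ_{0≤i≤n} c_i x^i
tau : ℕ → (ℕ → ℤ) → Poly
tau n c i = if i ≤ᵇ n then c i else + 0

deriv : Poly → Poly
deriv p i = + suc i ℤ.* p (suc i)

mulX : Poly → Poly
mulX p zero    = + 0
mulX p (suc i) = p i

infixl 6 _+ₚ_
infixr 7 _·ₚ_

_+ₚ_ : Poly → Poly → Poly
(p +ₚ q) i = p i ℤ.+ q i

_·ₚ_ : ℤ → Poly → Poly
(a ·ₚ p) i = a ℤ.* p i

mulXplus : ℕ → Poly → Poly
mulXplus k p = mulX p +ₚ ((+ k) ·ₚ p)

module Submission where

-- Colour u last. Under a proper colouring of G − u the neighbours of u form a clique, so they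
-- carry exactly k distinct colours and u has x − k admissible colours:
-- χ(G,x) = (x − k) χ(G − u,x). In the rising factorial basis multiplication by x − k acts by
-- (x − k)⟨x⟩ᵢ = ⟨x⟩ᵢ₊₁ − (i + k)⟨x⟩ᵢ, and coefficients in this basis are determined by the
-- values at all large x, since a forward difference lowers the degree:
-- ⟨x+1⟩ᵢ₊₁ − ⟨x⟩ᵢ₊₁ = (i + 1)⟨x+1⟩ᵢ. Comparing coefficients, the alternating signs cancel and
-- c_j = d_{j−1} + (j + k) d_j, the coefficientwise form of τ(G) = x τ'(G − u) + (x + k) τ(G − u).

open import Defs hiding (sym)
open import Data.Fin using (Fin; zero; suc)
open import Data.Nat using (ℕ; zero; suc; _∸_; _≤_; _<_; s≤s)
import Data.Nat.Properties as ℕ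
open import Function using (_∘_)
open import Relation.Binary.PropositionalEquality
  using (_≡_; _≢_; _≗_; refl; sym; trans; cong; cong₂; subst; module ≡-Reasoning)
open import Relation.Nullary using (yes; no; does; contradiction)

module Colourings where

  open import Algebra.Properties.CommutativeMonoid.Sum ℕ.+-0-commutativeMonoid
    using (sum-syntax; sum-remove; ∑-distrib-+; sum-replicate-zero; sum-cong-≗)
  open import Data.Bool using (Bool; true; false; not; _∧_; _∨_; if_then_else_)
  open import Data.Bool.Properties using (⇔→≡; ¬-not)
  open import Data.Fin using (punchIn; punchOut; _≟_)
  import Data.Fin.Properties as Fin
  open import Data.List
    using (List; []; _∷_; _++_; map; concatMap; filter; length; allFin; tabulate)
  open import Data.List.Properties using (map-cong; map-∘; map-++; map-tabulate; concatMap-cong)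
  open import Data.List.Membership.Propositional using (_∈_)
  open import Data.List.Membership.Propositional.Properties using (∈-allFin)
  open import Data.List.Relation.Unary.All as All using (All; []; _∷_)
  open import Data.List.Relation.Unary.All.Properties using (concat⁺; concat⁻; map⁺; map⁻)
  open import Data.Nat using (_+_; _*_)
  open import Data.Nat.ListAction using (sum)
  open import Data.Nat.ListAction.Properties using (sum-++)
  open import Data.Product using (_×_; _,_; proj₁; proj₂)
  open import Data.Vec.Functional as V using (insertAt)
  open import Data.Vec.Functional.Properties using (insertAt-lookup; insertAt-punchIn)
  open import Function using (mk⇔)
  open import Relation.Nullary.Decidable using (T?)

  ⟦_⟧ : Bool → ℕ
  ⟦ b ⟧ = if b then 1 else 0

  length-filter≡sum : ∀ {A : Set} (p : A → Bool) xs →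
    length (filter (λ a → T? (p a)) xs) ≡ sum (map (λ a → ⟦ p a ⟧) xs)
  length-filter≡sum p []       = refl
  length-filter≡sum p (a ∷ xs) with p a
  ... | true  = cong suc (length-filter≡sum p xs)
  ... | false = length-filter≡sum p xs

  sum-map-* : ∀ {A : Set} k (f : A → ℕ) xs →
    sum (map (λ a → k * f a) xs) ≡ k * sum (map f xs)
  sum-map-* k f []       = sym (ℕ.*-zeroʳ k)
  sum-map-* k f (a ∷ xs) =
    trans (cong (k * f a +_) (sum-map-* k f xs)) (sym (ℕ.*-distribˡ-+ k (f a) _))

  sum-map-concatMap : ∀ {A B : Set} (F : B → ℕ) (h : A → List B) xs →
    sum (map F (concatMap h xs)) ≡ sum (map (λ a → sum (map F (h a))) xs)
  sum-map-concatMap F h []       = refl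
  sum-map-concatMap F h (a ∷ xs) = begin
    sum (map F (h a ++ concatMap h xs))              ≡⟨ cong sum (map-++ F (h a) _) ⟩
    sum (map F (h a) ++ map F (concatMap h xs))      ≡⟨ sum-++ (map F (h a)) _ ⟩
    sum (map F (h a)) + sum (map F (concatMap h xs)) ≡⟨ cong (sum (map F (h a)) +_)
                                                              (sum-map-concatMap F h xs) ⟩
    sum (map F (h a)) + sum (map (λ a → sum (map F (h a))) xs) ∎
    where open ≡-Reasoning

  sum-map-allFin : ∀ {n} (f : Fin n → ℕ) → sum (map f (allFin n)) ≡ ∑[ i < n ] f i
  sum-map-allFin {n} f = trans (cong sum (map-tabulate (λ i → i) f)) (sum-tabulate n f)
    where
    sum-tabulate : ∀ n (f : Fin n → ℕ) → sum (tabulate f) ≡ ∑[ i < n ] f i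
    sum-tabulate zero    f = refl
    sum-tabulate (suc n) f = cong (f zero +_) (sum-tabulate n (f ∘ suc))

  sum-map-∑-comm : ∀ {A : Set} {x} (H : A → Fin x → ℕ) xs →
    sum (map (λ a → ∑[ c < x ] H a c) xs) ≡ ∑[ c < x ] sum (map (λ a → H a c) xs)
  sum-map-∑-comm {x = x} H []       = sym (sum-replicate-zero x)
  sum-map-∑-comm         H (a ∷ xs) =
    trans (cong (∑[ c < _ ] H a c +_) (sum-map-∑-comm H xs)) (sym (∑-distrib-+ (H a) _))

  ∑-one : ∀ n → ∑[ i < n ] 1 ≡ n
  ∑-one zero    = refl
  ∑-one (suc n) = cong suc (∑-one n)

  ∑-drop-point : ∀ {x} (q : Fin x → Bool) (a : Fin x) →
    ∑[ c < x ] ⟦ not (does (c ≟ a)) ∧ q c ⟧ + ⟦ q a ⟧ ≡ ∑[ c < x ] ⟦ q c ⟧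
  ∑-drop-point q zero    = ℕ.+-comm _ ⟦ q zero ⟧
  ∑-drop-point q (suc a) =
    trans (ℕ.+-assoc ⟦ q zero ⟧ _ _) (cong (⟦ q zero ⟧ +_) (∑-drop-point (q ∘ suc) a))

  data Split {n} (u : Fin (suc n)) : Fin (suc n) → Set where
    at    : Split u u
    other : ∀ j → Split u (punchIn u j)

  split : ∀ {n} (u v : Fin (suc n)) → Split u v
  split u v with u ≟ v
  ... | yes refl = at
  ... | no u≢v   = subst (Split u) (Fin.punchIn-punchOut u≢v) (other (punchOut u≢v))

  insertAt-cong : ∀ {n} {A : Set} {g g' : Fin n → A} → g ≗ g' →
    ∀ u c → insertAt g u c ≗ insertAt g' u c
  insertAt-cong {g = g} {g'} g≗g' u c v with split u v
  ... | at      = trans (insertAt-lookup g u c) (sym (insertAt-lookup g' u c))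
  ... | other j = trans (insertAt-punchIn g u c j) (trans (g≗g' j) (sym (insertAt-punchIn g' u c j)))

  insertAt-zero : ∀ {n} {A : Set} (g : Fin n → A) c → c V.∷ g ≗ insertAt g zero c
  insertAt-zero g c zero    = refl
  insertAt-zero g c (suc j) = refl

  insertAt-suc : ∀ {n} {A : Set} (c₀ : A) (g : Fin n → A) u c →
    c₀ V.∷ insertAt g u c ≗ insertAt (c₀ V.∷ g) (suc u) c
  insertAt-suc c₀ g u c zero    = refl
  insertAt-suc c₀ g u c (suc j) = refl

  -- Without function extensionality, summands over colourings must be assumed to respect
  -- pointwise equality of colourings.
  Extensional : ∀ {m x} → ((Fin m → Fin x) → ℕ) → Set
  Extensional F = ∀ {f f'} → f ≗ f' → F f ≡ F f'

  sum-allMaps-suc : ∀ n x (F : (Fin (suc n) → Fin x) → ℕ) → Extensional F →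
    sum (map F (allMaps (suc n) x)) ≡ sum (map (λ g → ∑[ c < x ] F (c V.∷ g)) (allMaps n x))
  sum-allMaps-suc n x F F-ext = trans (sum-map-concatMap F _ (allMaps n x))
    (cong sum (map-cong (λ g → sum-heads g _ λ c → λ { zero → refl ; (suc i) → refl }) (allMaps n x)))
    where
    sum-heads : ∀ g (cons : Fin x → Fin (suc n) → Fin x) → (∀ c → cons c ≗ c V.∷ g) →
      sum (map F (map cons (allFin x))) ≡ ∑[ c < x ] F (c V.∷ g)
    sum-heads g cons cons≗∷ = begin
      sum (map F (map cons (allFin x))) ≡⟨ cong sum (sym (map-∘ (allFin x))) ⟩
      sum (map (F ∘ cons) (allFin x))   ≡⟨ sum-map-allFin (F ∘ cons) ⟩
      ∑[ c < x ] F (cons c)             ≡⟨ sum-cong-≗ (λ c → F-ext (cons≗∷ c)) ⟩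
      ∑[ c < x ] F (c V.∷ g)            ∎
      where open ≡-Reasoning

  sum-allMaps-insertAt : ∀ n x (u : Fin (suc n)) (F : (Fin (suc n) → Fin x) → ℕ) → Extensional F →
    sum (map F (allMaps (suc n) x)) ≡ sum (map (λ g → ∑[ c < x ] F (insertAt g u c)) (allMaps n x))
  sum-allMaps-insertAt n x zero F F-ext = trans (sum-allMaps-suc n x F F-ext)
    (cong sum (map-cong (λ g → sum-cong-≗ λ c → F-ext (insertAt-zero g c)) (allMaps n x)))
  sum-allMaps-insertAt (suc m) x (suc u) F F-ext = begin
    sum (map F (allMaps (suc (suc m)) x))
      ≡⟨ sum-allMaps-suc (suc m) x F F-ext ⟩
    sum (map (λ g → ∑[ c₀ < x ] F (c₀ V.∷ g)) (allMaps (suc m) x))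
      ≡⟨ sum-map-∑-comm (λ g c₀ → F (c₀ V.∷ g)) (allMaps (suc m) x) ⟩
    ∑[ c₀ < x ] sum (map (λ g → F (c₀ V.∷ g)) (allMaps (suc m) x))
      ≡⟨ sum-cong-≗ (λ c₀ → sum-allMaps-insertAt m x u (λ g → F (c₀ V.∷ g)) (F-ext-∷ c₀)) ⟩
    ∑[ c₀ < x ] sum (map (λ g → ∑[ c < x ] F (c₀ V.∷ insertAt g u c)) (allMaps m x))
      ≡⟨ sym (sum-map-∑-comm (λ g c₀ → ∑[ c < x ] F (c₀ V.∷ insertAt g u c)) (allMaps m x)) ⟩
    sum (map (λ g → ∑[ c₀ < x ] ∑[ c < x ] F (c₀ V.∷ insertAt g u c)) (allMaps m x))
      ≡⟨ cong sum (map-cong (λ g → sum-cong-≗ λ c₀ → sum-cong-≗ λ c →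
           F-ext (insertAt-suc c₀ g u c)) (allMaps m x)) ⟩
    sum (map (λ g → ∑[ c₀ < x ] ∑[ c < x ] F (insertAt (c₀ V.∷ g) (suc u) c)) (allMaps m x))
      ≡⟨ sym (sum-allMaps-suc m x (λ g → ∑[ c < x ] F (insertAt g (suc u) c)) F-ext-insertAt) ⟩
    sum (map (λ g → ∑[ c < x ] F (insertAt g (suc u) c)) (allMaps (suc m) x)) ∎
    where
    open ≡-Reasoning
    F-ext-∷ : ∀ c₀ → Extensional (λ g → F (c₀ V.∷ g))
    F-ext-∷ c₀ g≗g' = F-ext λ { zero → refl ; (suc j) → g≗g' j }
    F-ext-insertAt : Extensional (λ g → ∑[ c < x ] F (insertAt g (suc u) c))
    F-ext-insertAt g≗g' = sum-cong-≗ λ c → F-ext (insertAt-cong g≗g' (suc u) c)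

  compatible : ∀ {x} → Bool → Fin x → Fin x → Bool
  compatible b c d = not b ∨ not (does (c ≟ d))

  compatible-sound : ∀ {x} b (c d : Fin x) → compatible b c d ≡ true → b ≡ true → c ≢ d
  compatible-sound true c d ok refl c≡d with c ≟ d
  compatible-sound true c d () refl c≡d | yes _
  ... | no c≢d = c≢d c≡d

  compatible-complete : ∀ {x} b (c d : Fin x) → (b ≡ true → c ≢ d) →
    compatible b c d ≡ true
  compatible-complete false c d h = refl
  compatible-complete true  c d h with c ≟ d
  ... | yes c≡d = contradiction c≡d (h refl)
  ... | no _    = refl

  Proper : ∀ {n x} → Graph n → (Fin n → Fin x) → Set
  Proper G f = ∀ i j → adj G i j ≡ true → f i ≢ f j

  andAll≡true⇒All : ∀ bs → andAll bs ≡ true → All (_≡ true) bs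
  andAll≡true⇒All []          _  = []
  andAll≡true⇒All (true ∷ bs) ok = refl ∷ andAll≡true⇒All bs ok

  All⇒andAll≡true : ∀ {bs} → All (_≡ true) bs → andAll bs ≡ true
  All⇒andAll≡true []          = refl
  All⇒andAll≡true (refl ∷ ps) = All⇒andAll≡true ps

  isProper-sound : ∀ {n x} (G : Graph n) (f : Fin n → Fin x) → isProper G f ≡ true → Proper G f
  isProper-sound {n} G f ok i j =
    compatible-sound (adj G i j) (f i) (f j) (All.lookup (map⁻ row-i) (∈-allFin j))
    where
    row-i = All.lookup (map⁻ (concat⁻ (andAll≡true⇒All _ ok))) (∈-allFin i)

  isProper-complete : ∀ {n x} (G : Graph n) (f : Fin n → Fin x) → Proper G f →
    isProper G f ≡ true
  isProper-complete {n} G f proper = All⇒andAll≡true (concat⁺ (map⁺ (All.tabulate row)))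
    where
    row : ∀ {i} → i ∈ allFin n →
      All (_≡ true) (map (λ j → compatible (adj G i j) (f i) (f j)) (allFin n))
    row {i} _ = map⁺ (All.tabulate λ {j} _ → compatible-complete (adj G i j) (f i) (f j) (proper i j))

  isProper-cong : ∀ {n x} (G : Graph n) {f f' : Fin n → Fin x} → f ≗ f' →
    isProper G f ≡ isProper G f'
  isProper-cong {n} G f≗f' = cong andAll (concatMap-cong (λ i →
    map-cong (λ j → cong₂ (compatible (adj G i j)) (f≗f' i) (f≗f' j)) (allFin n)) (allFin n))

  Avoids : ∀ {m x} → (Fin m → Bool) → (Fin m → Fin x) → Fin x → Set
  Avoids marked g c = ∀ j → marked j ≡ true → c ≢ g j

  neighbours : ∀ {n} → Graph (suc n) → Fin (suc n) → Fin n → Bool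
  neighbours G u = adj G u ∘ punchIn u

  module _ {n x} (G : Graph (suc n)) (u : Fin (suc n)) (c : Fin x) (g : Fin n → Fin x) where

    Proper-insertAt⁻ : Proper G (insertAt g u c) → Proper (delete G u) g × Avoids (neighbours G u) g c
    Proper-insertAt⁻ proper = proper-g , avoid
      where
      proper-g : Proper (delete G u) g
      proper-g i j i~j gi≡gj = proper (punchIn u i) (punchIn u j) i~j
        (trans (insertAt-punchIn g u c i) (trans gi≡gj (sym (insertAt-punchIn g u c j))))
      avoid : Avoids (neighbours G u) g c
      avoid j u~j c≡gj = proper u (punchIn u j) u~j
        (trans (insertAt-lookup g u c) (trans c≡gj (sym (insertAt-punchIn g u c j))))

    Proper-insertAt⁺ : Proper (delete G u) g → Avoids (neighbours G u) g c → Proper G (insertAt g u c)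
    Proper-insertAt⁺ proper-g avoid v w v~w with split u v | split u w
    ... | at      | at      = contradiction (trans (sym (irrefl G u)) v~w) λ ()
    ... | at      | other j rewrite insertAt-lookup g u c | insertAt-punchIn g u c j = avoid j v~w
    ... | other i | at      rewrite insertAt-lookup g u c | insertAt-punchIn g u c i =
      avoid i (trans (Graph.sym G u (punchIn u i)) v~w) ∘ sym
    ... | other i | other j rewrite insertAt-punchIn g u c i | insertAt-punchIn g u c j =
      proper-g i j v~w

  avoids : ∀ {m x} → (Fin m → Bool) → (Fin m → Fin x) → Fin x → Bool
  avoids {zero}  marked g c = true
  avoids {suc m} marked g c = compatible (marked zero) c (g zero) ∧ avoids (marked ∘ suc) (g ∘ suc) c

  avoids-sound : ∀ {m x} (marked : Fin m → Bool) (g : Fin m → Fin x) c →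
    avoids marked g c ≡ true → Avoids marked g c
  avoids-sound {suc m} marked g c ok j with compatible (marked zero) c (g zero) in head-ok
  avoids-sound {suc m} marked g c ok zero    | true = compatible-sound _ c (g zero) head-ok
  avoids-sound {suc m} marked g c ok (suc j) | true = avoids-sound (marked ∘ suc) (g ∘ suc) c ok j

  avoids-complete : ∀ {m x} (marked : Fin m → Bool) (g : Fin m → Fin x) c →
    Avoids marked g c → avoids marked g c ≡ true
  avoids-complete {zero}  marked g c h = refl
  avoids-complete {suc m} marked g c h rewrite compatible-complete (marked zero) c (g zero) (h zero) =
    avoids-complete (marked ∘ suc) (g ∘ suc) c (h ∘ suc)

  InjectiveOn : ∀ {m x} → (Fin m → Bool) → (Fin m → Fin x) → Set
  InjectiveOn marked g = ∀ i j → marked i ≡ true → marked j ≡ true → i ≢ j → g i ≢ g j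

  InjectiveOn-tail : ∀ {m x} {marked : Fin (suc m) → Bool} {g : Fin (suc m) → Fin x} →
    InjectiveOn marked g → InjectiveOn (marked ∘ suc) (g ∘ suc)
  InjectiveOn-tail injective i j mi mj i≢j =
    injective (suc i) (suc j) mi mj (i≢j ∘ Fin.suc-injective)

  ∑-avoids : ∀ {m x} (marked : Fin m → Bool) (g : Fin m → Fin x) → InjectiveOn marked g →
    ∑[ c < x ] ⟦ avoids marked g c ⟧ + ∑[ j < m ] ⟦ marked j ⟧ ≡ x
  ∑-avoids {zero}  {x} marked g injective = trans (ℕ.+-identityʳ _) (∑-one x)
  ∑-avoids {suc m} {x} marked g injective with marked zero in marked-0
  ... | false = ∑-avoids (marked ∘ suc) (g ∘ suc) (InjectiveOn-tail injective)
  ... | true  = begin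
    remaining + (1 + others)              ≡⟨ cong (λ b → remaining + (⟦ b ⟧ + others)) (sym avoids-g₀) ⟩
    remaining + (⟦ q (g zero) ⟧ + others) ≡⟨ sym (ℕ.+-assoc remaining ⟦ q (g zero) ⟧ others) ⟩
    remaining + ⟦ q (g zero) ⟧ + others   ≡⟨ cong (_+ others) (∑-drop-point q (g zero)) ⟩
    ∑[ c < x ] ⟦ q c ⟧ + others           ≡⟨ ∑-avoids (marked ∘ suc) (g ∘ suc)
                                                      (InjectiveOn-tail injective) ⟩
    x                                     ∎
    where
    open ≡-Reasoning
    q = avoids (marked ∘ suc) (g ∘ suc)
    remaining = ∑[ c < x ] ⟦ not (does (c ≟ g zero)) ∧ q c ⟧
    others = ∑[ j < m ] ⟦ marked (suc j) ⟧
    avoids-g₀ : q (g zero) ≡ true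
    avoids-g₀ = avoids-complete (marked ∘ suc) (g ∘ suc) (g zero)
      λ j mj → injective zero (suc j) marked-0 mj λ ()

  degree≡∑-neighbours : ∀ {n} (G : Graph (suc n)) u → degree G u ≡ ∑[ j < n ] ⟦ neighbours G u j ⟧
  degree≡∑-neighbours {n} G u = begin
    degree G u                                       ≡⟨ length-filter≡sum (adj G u) (allFin (suc n)) ⟩
    sum (map (λ v → ⟦ adj G u v ⟧) (allFin (suc n))) ≡⟨ sum-map-allFin (λ v → ⟦ adj G u v ⟧) ⟩
    ∑[ v < suc n ] ⟦ adj G u v ⟧                     ≡⟨ sum-remove {i = u} (λ v → ⟦ adj G u v ⟧) ⟩
    ⟦ adj G u u ⟧ + others                           ≡⟨ cong (λ b → ⟦ b ⟧ + others) (irrefl G u) ⟩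
    others                                           ∎
    where
    open ≡-Reasoning
    others = ∑[ j < n ] ⟦ neighbours G u j ⟧

  ∑-extensions : ∀ {n} (G : Graph (suc n)) u → Simplicial G u → ∀ x (g : Fin n → Fin x) →
    ∑[ c < x ] ⟦ isProper G (insertAt g u c) ⟧ ≡ (x ∸ degree G u) * ⟦ isProper (delete G u) g ⟧
  ∑-extensions {n} G u simplicial x g with isProper (delete G u) g in proper-g
  ... | false = begin
    ∑[ c < x ] ⟦ isProper G (insertAt g u c) ⟧ ≡⟨ sum-cong-≗ (λ c → cong ⟦_⟧ (improper c)) ⟩
    ∑[ c < x ] 0                               ≡⟨ sum-replicate-zero x ⟩
    0                                          ≡⟨ sym (ℕ.*-zeroʳ (x ∸ degree G u)) ⟩
    (x ∸ degree G u) * 0                       ∎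
    where
    open ≡-Reasoning
    improper : ∀ c → isProper G (insertAt g u c) ≡ false
    improper c = ¬-not λ proper → contradiction (trans (sym proper-g) (isProper-complete (delete G u) g
      (proj₁ (Proper-insertAt⁻ G u c g (isProper-sound G _ proper))))) λ ()
  ... | true = begin
    ∑[ c < x ] ⟦ isProper G (insertAt g u c) ⟧       ≡⟨ sum-cong-≗ (cong ⟦_⟧ ∘ proper≡avoids) ⟩
    avoiding                                         ≡⟨ sym (ℕ.m+n∸n≡m avoiding (degree G u)) ⟩
    avoiding + degree G u ∸ degree G u               ≡⟨ cong (λ k → avoiding + k ∸ degree G u)
                                                             (degree≡∑-neighbours G u) ⟩
    avoiding + ∑[ j < n ] ⟦ neighbours G u j ⟧ ∸ degree G u
                                                     ≡⟨ cong (_∸ degree G u)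
                                                             (∑-avoids (neighbours G u) g injective) ⟩
    x ∸ degree G u                                   ≡⟨ sym (ℕ.*-identityʳ (x ∸ degree G u)) ⟩
    (x ∸ degree G u) * 1                             ∎
    where
    open ≡-Reasoning
    avoiding = ∑[ c < x ] ⟦ avoids (neighbours G u) g c ⟧
    proper = isProper-sound (delete G u) g proper-g
    proper≡avoids : ∀ c → isProper G (insertAt g u c) ≡ avoids (neighbours G u) g c
    proper≡avoids c = ⇔→≡ {z = true} (mk⇔
      (λ p → avoids-complete (neighbours G u) g c (proj₂ (Proper-insertAt⁻ G u c g (isProper-sound G _ p))))
      (λ a → isProper-complete G _ (Proper-insertAt⁺ G u c g proper (avoids-sound (neighbours G u) g c a))))
    injective : InjectiveOn (neighbours G u) g
    injective i j u~i u~j i≢j =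
      proper i j (simplicial (punchIn u i) (punchIn u j) u~i u~j (i≢j ∘ Fin.punchIn-injective u i j))

  chrom-simplicial : ∀ {n} (G : Graph (suc n)) u → Simplicial G u →
    ∀ x → chrom G x ≡ (x ∸ degree G u) * chrom (delete G u) x
  chrom-simplicial {n} G u simplicial x = begin
    chrom G x
      ≡⟨ length-filter≡sum (isProper G) (allMaps (suc n) x) ⟩
    sum (map (λ f → ⟦ isProper G f ⟧) (allMaps (suc n) x))
      ≡⟨ sum-allMaps-insertAt n x u (λ f → ⟦ isProper G f ⟧) (cong ⟦_⟧ ∘ isProper-cong G) ⟩
    sum (map (λ g → ∑[ c < x ] ⟦ isProper G (insertAt g u c) ⟧) (allMaps n x))
      ≡⟨ cong sum (map-cong (∑-extensions G u simplicial x) (allMaps n x)) ⟩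
    sum (map (λ g → (x ∸ k) * ⟦ isProper (delete G u) g ⟧) (allMaps n x))
      ≡⟨ sum-map-* (x ∸ k) (λ g → ⟦ isProper (delete G u) g ⟧) (allMaps n x) ⟩
    (x ∸ k) * sum (map (λ g → ⟦ isProper (delete G u) g ⟧) (allMaps n x))
      ≡⟨ cong ((x ∸ k) *_) (sym (length-filter≡sum (isProper (delete G u)) (allMaps n x))) ⟩
    (x ∸ k) * chrom (delete G u) x ∎
    where
    open ≡-Reasoning
    k = degree G u

module RisingBasis where

  open import Data.Bool using (true; false; T)
  open import Data.Integer using (ℤ; +_; -1ℤ; 0ℤ; 1ℤ; _^_; _+_; _*_; _-_)
  import Data.Integer.Properties as ℤ
  open import Data.Integer.Tactic.RingSolver using (solve-∀)
  open import Data.Nat using (z≤n; _≤ᵇ_)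
  import Data.Nat as ℕ
  import Data.Nat.Tactic.RingSolver as ℕ
  open import Data.Sum using (inj₁; inj₂)

  sumTo-cong : ∀ m {f g : ℕ → ℤ} → (∀ i → i ≤ m → f i ≡ g i) → sumTo m f ≡ sumTo m g
  sumTo-cong zero    f≗g = f≗g 0 z≤n
  sumTo-cong (suc m) f≗g =
    cong₂ _+_ (sumTo-cong m (λ i i≤m → f≗g i (ℕ.m≤n⇒m≤1+n i≤m))) (f≗g (suc m) ℕ.≤-refl)

  sumTo-+ : ∀ m (f g : ℕ → ℤ) → sumTo m (λ i → f i + g i) ≡ sumTo m f + sumTo m g
  sumTo-+ zero    f g = refl
  sumTo-+ (suc m) f g = trans (cong (_+ (f (suc m) + g (suc m))) (sumTo-+ m f g))
    (interchange (sumTo m f) (sumTo m g) (f (suc m)) (g (suc m)))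
    where
    interchange : ∀ a b c d → (a + b) + (c + d) ≡ (a + c) + (b + d)
    interchange = solve-∀

  sumTo-minus : ∀ m (f g : ℕ → ℤ) → sumTo m (λ i → f i - g i) ≡ sumTo m f - sumTo m g
  sumTo-minus zero    f g = refl
  sumTo-minus (suc m) f g = trans (cong (_+ (f (suc m) - g (suc m))) (sumTo-minus m f g))
    (interchange (sumTo m f) (sumTo m g) (f (suc m)) (g (suc m)))
    where
    interchange : ∀ a b c d → (a - b) + (c - d) ≡ (a + c) - (b + d)
    interchange = solve-∀

  sumTo-*ˡ : ∀ m a (f : ℕ → ℤ) → a * sumTo m f ≡ sumTo m (λ i → a * f i)
  sumTo-*ˡ zero    a f = refl
  sumTo-*ˡ (suc m) a f =
    trans (ℤ.*-distribˡ-+ a (sumTo m f) _) (cong (_+ a * f (suc m)) (sumTo-*ˡ m a f))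

  sumTo-suc : ∀ m (f : ℕ → ℤ) → sumTo (suc m) f ≡ f 0 + sumTo m (f ∘ suc)
  sumTo-suc zero    f = refl
  sumTo-suc (suc m) f = trans (cong (_+ f (suc (suc m))) (sumTo-suc m f)) (ℤ.+-assoc (f 0) _ _)

  sumTo-zero : ∀ m (f : ℕ → ℤ) → (∀ i → i ≤ m → f i ≡ 0ℤ) → sumTo m f ≡ 0ℤ
  sumTo-zero zero    f f≡0 = f≡0 0 z≤n
  sumTo-zero (suc m) f f≡0 =
    cong₂ _+_ (sumTo-zero m f (λ i i≤m → f≡0 i (ℕ.m≤n⇒m≤1+n i≤m))) (f≡0 (suc m) ℕ.≤-refl)

  rising-suc : ∀ y i → rising y (suc i) ≡ y ℕ.* rising (suc y) i
  rising-suc y zero    = trans (ℕ.*-identityˡ (y ℕ.+ 0)) (trans (ℕ.+-identityʳ y) (sym (ℕ.*-identityʳ y)))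
  rising-suc y (suc i) = begin
    rising y (suc i) ℕ.* (y ℕ.+ suc i)         ≡⟨ cong₂ ℕ._*_ (rising-suc y i) (ℕ.+-suc y i) ⟩
    y ℕ.* rising (suc y) i ℕ.* (suc y ℕ.+ i)   ≡⟨ ℕ.*-assoc y _ _ ⟩
    y ℕ.* (rising (suc y) i ℕ.* (suc y ℕ.+ i)) ∎
    where open ≡-Reasoning

  rising-difference : ∀ y i →
    rising (suc y) (suc i) ≡ rising y (suc i) ℕ.+ suc i ℕ.* rising (suc y) i
  rising-difference y i = trans (distrib (rising (suc y) i) y i)
    (cong (ℕ._+ suc i ℕ.* rising (suc y) i) (sym (rising-suc y i)))
    where
    distrib : ∀ r y i → r ℕ.* (suc y ℕ.+ i) ≡ y ℕ.* r ℕ.+ suc i ℕ.* r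
    distrib = ℕ.solve-∀

  +rising-suc : ∀ x i → + rising x (suc i) ≡ + rising x i * (+ x + + i)
  +rising-suc x i = trans (ℤ.pos-* (rising x i) (x ℕ.+ i)) (cong (+ rising x i *_) (ℤ.pos-+ x i))

  risingSum : ℕ → Poly → ℕ → ℤ
  risingSum m p x = sumTo m (λ i → p i * + rising x i)

  risingSum-cong : ∀ m {p q : Poly} → (∀ i → i ≤ m → p i ≡ q i) →
    ∀ x → risingSum m p x ≡ risingSum m q x
  risingSum-cong m p≗q x = sumTo-cong m (λ i i≤m → cong (_* + rising x i) (p≗q i i≤m))

  risingSum-minus : ∀ m (p q : Poly) x →
    risingSum m (λ i → p i - q i) x ≡ risingSum m p x - risingSum m q x
  risingSum-minus m p q x = trans (sumTo-cong m (λ i _ → distrib (p i) (q i) (+ rising x i)))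
    (sumTo-minus m (λ i → p i * + rising x i) _)
    where
    distrib : ∀ a b r → (a - b) * r ≡ a * r - b * r
    distrib = solve-∀

  risingSum-difference : ∀ m (z : Poly) y →
    risingSum (suc m) z (suc y) ≡ risingSum (suc m) z y + risingSum m (deriv z) (suc y)
  risingSum-difference m z y = begin
    risingSum (suc m) z (suc y)
      ≡⟨ sumTo-suc m _ ⟩
    z 0 * 1ℤ + sumTo m (λ i → z (suc i) * + rising (suc y) (suc i))
      ≡⟨ cong (λ s → z 0 * 1ℤ + s) (sumTo-cong m (λ i _ → split-term i)) ⟩
    z 0 * 1ℤ + sumTo m (λ i → z (suc i) * + rising y (suc i) + deriv z i * + rising (suc y) i)
      ≡⟨ cong (λ s → z 0 * 1ℤ + s) (sumTo-+ m _ _) ⟩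
    z 0 * 1ℤ + (sumTo m (λ i → z (suc i) * + rising y (suc i)) + risingSum m (deriv z) (suc y))
      ≡⟨ sym (ℤ.+-assoc (z 0 * 1ℤ) _ _) ⟩
    z 0 * 1ℤ + sumTo m (λ i → z (suc i) * + rising y (suc i)) + risingSum m (deriv z) (suc y)
      ≡⟨ cong (_+ risingSum m (deriv z) (suc y)) (sym (sumTo-suc m _)) ⟩
    risingSum (suc m) z y + risingSum m (deriv z) (suc y) ∎
    where
    open ≡-Reasoning
    distrib : ∀ a r s j → a * (r + j * s) ≡ a * r + (j * a) * s
    distrib = solve-∀
    split-term : ∀ i → z (suc i) * + rising (suc y) (suc i)
                     ≡ z (suc i) * + rising y (suc i) + deriv z i * + rising (suc y) i
    split-term i = begin
      z (suc i) * + rising (suc y) (suc i)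
        ≡⟨ cong (z (suc i) *_) (trans (cong +_ (rising-difference y i)) (ℤ.pos-+ (rising y (suc i)) _)) ⟩
      z (suc i) * (+ rising y (suc i) + + (suc i ℕ.* rising (suc y) i))
        ≡⟨ cong (λ r → z (suc i) * (+ rising y (suc i) + r)) (ℤ.pos-* (suc i) _) ⟩
      z (suc i) * (+ rising y (suc i) + + suc i * + rising (suc y) i)
        ≡⟨ distrib (z (suc i)) (+ rising y (suc i)) (+ rising (suc y) i) (+ suc i) ⟩
      z (suc i) * + rising y (suc i) + deriv z i * + rising (suc y) i ∎

  deriv≡0⇒≡0 : ∀ (z : Poly) i → deriv z i ≡ 0ℤ → z (suc i) ≡ 0ℤ
  deriv≡0⇒≡0 z i eq with ℤ.i*j≡0⇒i≡0∨j≡0 (+ suc i) eq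
  ... | inj₂ z≡0 = z≡0

  risingSum≡0⇒≡0 : ∀ m (z : Poly) K → (∀ y → K ≤ y → risingSum m z y ≡ 0ℤ) →
    ∀ i → i ≤ m → z i ≡ 0ℤ
  risingSum≡0⇒≡0 zero    z K vanishes zero _ = trans (sym (ℤ.*-identityʳ (z 0))) (vanishes K ℕ.≤-refl)
  risingSum≡0⇒≡0 (suc m) z K vanishes = coefficient
    where
    open ≡-Reasoning
    difference-vanishes : ∀ y → suc K ≤ y → risingSum m (deriv z) y ≡ 0ℤ
    difference-vanishes (suc y) (s≤s K≤y) = begin
      risingSum m (deriv z) (suc y)                          ≡⟨ sym (ℤ.+-identityˡ _) ⟩
      0ℤ + risingSum m (deriv z) (suc y)                     ≡⟨ cong (_+ risingSum m (deriv z) (suc y))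
                                                                     (sym (vanishes y K≤y)) ⟩
      risingSum (suc m) z y + risingSum m (deriv z) (suc y) ≡⟨ sym (risingSum-difference m z y) ⟩
      risingSum (suc m) z (suc y)                            ≡⟨ vanishes (suc y) (ℕ.m≤n⇒m≤1+n K≤y) ⟩
      0ℤ                                                     ∎
    higher : ∀ i → i ≤ m → z (suc i) ≡ 0ℤ
    higher i i≤m = deriv≡0⇒≡0 z i (risingSum≡0⇒≡0 m (deriv z) (suc K) difference-vanishes i i≤m)
    coefficient : ∀ i → i ≤ suc m → z i ≡ 0ℤ
    coefficient zero    _         = begin
      z 0                                                       ≡⟨ sym (ℤ.*-identityʳ (z 0)) ⟩
      z 0 * 1ℤ                                                  ≡⟨ sym (ℤ.+-identityʳ (z 0 * 1ℤ)) ⟩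
      z 0 * 1ℤ + 0ℤ                                             ≡⟨ cong (λ s → z 0 * 1ℤ + s) (sym
                                                                    (sumTo-zero m _ λ i i≤m →
                                                                      cong (_* + rising K (suc i)) (higher i i≤m))) ⟩
      z 0 * 1ℤ + sumTo m (λ i → z (suc i) * + rising K (suc i)) ≡⟨ sym (sumTo-suc m _) ⟩
      risingSum (suc m) z K                                     ≡⟨ vanishes K ℕ.≤-refl ⟩
      0ℤ                                                        ∎
    coefficient (suc i) (s≤s i≤m) = higher i i≤m

  risingSum-injective : ∀ m (p q : Poly) K → (∀ y → K ≤ y → risingSum m p y ≡ risingSum m q y) →
    ∀ i → i ≤ m → p i ≡ q i
  risingSum-injective m p q K agree i i≤m = ℤ.i-j≡0⇒i≡j (p i) (q i)
    (risingSum≡0⇒≡0 m (λ i → p i - q i) K difference-vanishes i i≤m)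
    where
    difference-vanishes : ∀ y → K ≤ y → risingSum m (λ i → p i - q i) y ≡ 0ℤ
    difference-vanishes y K≤y = trans (risingSum-minus m p q y) (ℤ.i≡j⇒i-j≡0 (agree y K≤y))

  -- Rising-basis coefficients of (x − k) · p, from (x − k)⟨x⟩ᵢ = ⟨x⟩ᵢ₊₁ − (i + k)⟨x⟩ᵢ.
  risingMulXMinus : ℕ → Poly → Poly
  risingMulXMinus k q j = mulX q j - (+ j + + k) * q j

  risingSum-mulXMinus : ∀ n k (q : Poly) x → q (suc n) ≡ 0ℤ →
    (+ x - + k) * risingSum n q x ≡ risingSum (suc n) (risingMulXMinus k q) x
  risingSum-mulXMinus n k q x top≡0 = begin
    (+ x - + k) * risingSum n q x
      ≡⟨ sumTo-*ˡ n (+ x - + k) _ ⟩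
    sumTo n (λ i → (+ x - + k) * (q i * + rising x i))
      ≡⟨ sumTo-cong n (λ i _ → raise i) ⟩
    sumTo n (λ i → q i * + rising x (suc i) - weighted i * + rising x i)
      ≡⟨ sumTo-minus n (λ i → q i * + rising x (suc i)) (λ i → weighted i * + rising x i) ⟩
    sumTo n (λ i → q i * + rising x (suc i)) - risingSum n weighted x
      ≡⟨ cong₂ _-_ (sym shifted) (sym extended) ⟩
    risingSum (suc n) (mulX q) x - risingSum (suc n) weighted x
      ≡⟨ sym (risingSum-minus (suc n) (mulX q) weighted x) ⟩
    risingSum (suc n) (risingMulXMinus k q) x ∎
    where
    open ≡-Reasoning
    weighted : Poly
    weighted j = (+ j + + k) * q j
    expand : ∀ X K Q R I → (X - K) * (Q * R) ≡ Q * (R * (X + I)) - ((I + K) * Q) * R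
    expand = solve-∀
    raise : ∀ i → (+ x - + k) * (q i * + rising x i) ≡ q i * + rising x (suc i) - weighted i * + rising x i
    raise i = trans (expand (+ x) (+ k) (q i) (+ rising x i) (+ i))
      (cong (λ r → q i * r - weighted i * + rising x i) (sym (+rising-suc x i)))
    shifted : risingSum (suc n) (mulX q) x ≡ sumTo n (λ i → q i * + rising x (suc i))
    shifted = trans (sumTo-suc n _) (ℤ.+-identityˡ _)
    extended : risingSum (suc n) weighted x ≡ risingSum n weighted x
    extended rewrite top≡0 | ℤ.*-zeroʳ (+ suc n + + k) = ℤ.+-identityʳ (risingSum n weighted x)

  sign : ℕ → ℤ
  sign m = -1ℤ ^ m

  sign-square : ∀ m → sign m * sign m ≡ 1ℤ
  sign-square zero    = refl
  sign-square (suc m) = trans (negate-square (sign m)) (sign-square m)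
    where
    negate-square : ∀ s → (-1ℤ * s) * (-1ℤ * s) ≡ s * s
    negate-square = solve-∀

  sign-cancel : ∀ m {a b} → sign m * a ≡ sign m * b → a ≡ b
  sign-cancel m {a} {b} eq = begin
    a                     ≡⟨ sym (ℤ.*-identityˡ a) ⟩
    1ℤ * a                ≡⟨ cong (_* a) (sym (sign-square m)) ⟩
    sign m * sign m * a   ≡⟨ ℤ.*-assoc (sign m) _ a ⟩
    sign m * (sign m * a) ≡⟨ cong (sign m *_) eq ⟩
    sign m * (sign m * b) ≡⟨ sym (ℤ.*-assoc (sign m) _ b) ⟩
    sign m * sign m * b   ≡⟨ cong (_* b) (sign-square m) ⟩
    1ℤ * b                ≡⟨ ℤ.*-identityˡ b ⟩
    b                     ∎
    where open ≡-Reasoning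

  -- IsCoeffs H c unfolds to: + chrom H x ≡ risingSum n (signed n c) x.
  signed : ℕ → Poly → Poly
  signed n p i = sign (n ∸ i) * p i

  risingMulXMinus-signed : ∀ n k (D : Poly) → (∀ j → n < j → D j ≡ 0ℤ) →
    ∀ j → risingMulXMinus k (signed n D) j ≡ sign (suc n ∸ j) * (mulX D j + (+ j + + k) * D j)
  risingMulXMinus-signed n k D D-vanishes zero = constant (sign n) (+ k) (D 0)
    where
    constant : ∀ s K a → + 0 - (+ 0 + K) * (s * a) ≡ (-1ℤ * s) * (+ 0 + (+ 0 + K) * a)
    constant = solve-∀
  risingMulXMinus-signed n k D D-vanishes (suc i) with ℕ.<-≤-connex i n
  ... | inj₁ i<n = begin
    sign (n ∸ i) * D i - w * (sign (n ∸ suc i) * D (suc i))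
      ≡⟨ cong (λ s → s * D i - w * (sign (n ∸ suc i) * D (suc i))) sign-step ⟩
    (-1ℤ * sign (n ∸ suc i)) * D i - w * (sign (n ∸ suc i) * D (suc i))
      ≡⟨ alternate (sign (n ∸ suc i)) (D i) (D (suc i)) w ⟩
    (-1ℤ * sign (n ∸ suc i)) * (D i + w * D (suc i))
      ≡⟨ cong (λ s → s * (D i + w * D (suc i))) (sym sign-step) ⟩
    sign (n ∸ i) * (D i + w * D (suc i)) ∎
    where
    open ≡-Reasoning
    w = + suc i + + k
    sign-step : sign (n ∸ i) ≡ -1ℤ * sign (n ∸ suc i)
    sign-step = cong sign (ℕ.+-∸-assoc 1 i<n)
    alternate : ∀ s a b w → (-1ℤ * s) * a - w * (s * b) ≡ (-1ℤ * s) * (a + w * b)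
    alternate = solve-∀
  ... | inj₂ n≤i rewrite D-vanishes (suc i) (s≤s n≤i) =
    top (sign (n ∸ i)) (sign (n ∸ suc i)) (D i) (+ suc i + + k)
    where
    top : ∀ s s' a w → s * a - w * (s' * + 0) ≡ s * (a + w * + 0)
    top = solve-∀

  mulX-deriv-+-mulXplus : ∀ k (p : Poly) j →
    (mulX (deriv p) +ₚ mulXplus k p) j ≡ mulX p j + (+ j + + k) * p j
  mulX-deriv-+-mulXplus k p zero    = constant (+ k) (p 0)
    where
    constant : ∀ K a → + 0 + (+ 0 + K * a) ≡ + 0 + (+ 0 + K) * a
    constant = solve-∀
  mulX-deriv-+-mulXplus k p (suc i) = regroup (+ suc i) (+ k) (p i) (p (suc i))
    where
    regroup : ∀ I K a b → I * b + (a + K * b) ≡ a + (I + K) * b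
    regroup = solve-∀

  mulX-deriv-+-mulXplus-vanishes : ∀ n k (p : Poly) → (∀ j → n < j → p j ≡ 0ℤ) →
    ∀ j → suc n < j → (mulX (deriv p) +ₚ mulXplus k p) j ≡ 0ℤ
  mulX-deriv-+-mulXplus-vanishes n k p p-vanishes (suc i) (s≤s n<i)
    rewrite mulX-deriv-+-mulXplus k p (suc i) | p-vanishes i n<i | p-vanishes (suc i) (ℕ.m<n⇒m<1+n n<i) =
    trans (ℤ.+-identityˡ _) (ℤ.*-zeroʳ (+ suc i + + k))

  tau-≤ : ∀ n (c : Poly) i → i ≤ n → tau n c i ≡ c i
  tau-≤ n c i i≤n with i ≤ᵇ n | ℕ.≤⇒≤ᵇ i≤n
  ... | true | _ = refl

  tau-> : ∀ n (c : Poly) i → n < i → tau n c i ≡ 0ℤ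
  tau-> n c i n<i with i ≤ᵇ n in i≤ᵇn
  ... | false = refl
  ... | true  = contradiction (ℕ.≤ᵇ⇒≤ i n (subst T (sym i≤ᵇn) _)) (ℕ.<⇒≱ n<i)

  tau≗ : ∀ n (c R : Poly) → (∀ j → j ≤ n → c j ≡ R j) → (∀ j → n < j → R j ≡ 0ℤ) →
    ∀ j → tau n c j ≡ R j
  tau≗ n c R low high j with j ℕ.≤? n
  ... | yes j≤n = trans (tau-≤ n c j j≤n) (low j j≤n)
  ... | no  j≰n = trans (tau-> n c j (ℕ.≰⇒> j≰n)) (sym (high j (ℕ.≰⇒> j≰n)))

open Colourings using (chrom-simplicial)
open RisingBasis
import Data.Nat as ℕ
open import Data.Integer using (ℤ; +_; 0ℤ; _+_; _*_; _-_)
import Data.Integer.Properties as ℤ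

risingSum-simplicial : ∀ {n} (G : Graph (suc n)) u (c d : ℕ → ℤ) → Simplicial G u →
  IsCoeffs G c → IsCoeffs (delete G u) d → ∀ y → degree G u ≤ y →
  risingSum (suc n) (signed (suc n) c) y
    ≡ risingSum (suc n) (risingMulXMinus (degree G u) (signed n (tau n d))) y
risingSum-simplicial {n} G u c d simplicial c-coeffs d-coeffs y k≤y = begin
  risingSum (suc n) (signed (suc n) c) y
    ≡⟨ sym (c-coeffs y) ⟩
  + chrom G y
    ≡⟨ cong +_ (chrom-simplicial G u simplicial y) ⟩
  + ((y ∸ k) ℕ.* chrom (delete G u) y)
    ≡⟨ ℤ.pos-* (y ∸ k) _ ⟩
  + (y ∸ k) * + chrom (delete G u) y
    ≡⟨ cong₂ _*_ (trans (sym (ℤ.⊖-≥ k≤y)) (sym (ℤ.m-n≡m⊖n y k))) (d-coeffs y) ⟩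
  (+ y - + k) * risingSum n (signed n d) y
    ≡⟨ cong ((+ y - + k) *_) (risingSum-cong n (λ i i≤n → cong (sign (n ∸ i) *_)
         (sym (tau-≤ n d i i≤n))) y) ⟩
  (+ y - + k) * risingSum n (signed n (tau n d)) y
    ≡⟨ risingSum-mulXMinus n k (signed n (tau n d)) y top≡0 ⟩
  risingSum (suc n) (risingMulXMinus k (signed n (tau n d))) y ∎
  where
  open ≡-Reasoning
  k = degree G u
  top≡0 : signed n (tau n d) (suc n) ≡ 0ℤ
  top≡0 = trans (cong (sign (n ∸ suc n) *_) (tau-> n d (suc n) ℕ.≤-refl)) (ℤ.*-zeroʳ (sign (n ∸ suc n)))

mainTheorem10 : ∀ {n : ℕ} (G : Graph (suc n)) (u : Fin (suc n)) (c d : ℕ → ℤ)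
    → Simplicial G u
    → IsCoeffs G c
    → IsCoeffs (delete G u) d
    → ∀ (i : ℕ) → tau (suc n) c i ≡ (mulX (deriv (tau n d)) +ₚ mulXplus (degree G u) (tau n d)) i
mainTheorem10 {n} G u c d simplicial c-coeffs d-coeffs =
  tau≗ (suc n) c R coefficients (mulX-deriv-+-mulXplus-vanishes n k D (tau-> n d))
  where
  open ≡-Reasoning
  k = degree G u
  D = tau n d
  R = mulX (deriv D) +ₚ mulXplus k D
  coefficients : ∀ j → j ≤ suc n → c j ≡ R j
  coefficients j j≤1+n = sign-cancel (suc n ∸ j) (begin
    signed (suc n) c j
      ≡⟨ risingSum-injective (suc n) (signed (suc n) c) (risingMulXMinus k (signed n D)) k
           (risingSum-simplicial G u c d simplicial c-coeffs d-coeffs) j j≤1+n ⟩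
    risingMulXMinus k (signed n D) j
      ≡⟨ risingMulXMinus-signed n k D (tau-> n d) j ⟩
    sign (suc n ∸ j) * (mulX D j + (+ j + + k) * D j)
      ≡⟨ cong (sign (suc n ∸ j) *_) (sym (mulX-deriv-+-mulXplus k D j)) ⟩
    sign (suc n ∸ j) * R j ∎)
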